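{- Let $h\ge 4$ be an integer. Let $A=\{0,a_2,\ldots,a_{h+1}\}$ be a set of nonnegative integers such that $0<a_2<\cdots<a_{h+1}$ and every element of $A\setminus\{0\}$ is odd. Then \[ |h^{\wedge}_{\pm}A| \geq |h^{\wedge}_{\pm}A_1| + |h^{\wedge}_{\pm}A_2|, \] where $A_1=A\setminus\{0\}$ and $A_2=A\setminus\{a_2\}$. Hence $|h^{\wedge}_{\pm}A|\geq 2h(h-1)-1$.
   Context: For a finite set $A=\{a_1,\ldots,a_k\}$ of integers and a positive integer $h$, the restricted $h$-fold signed sumset is $h^{\wedge}_{\pm}A=\left\{\sum_{i=1}^{k}\lambda_i a_i : \lambda_i\in\{ -1,0,1\} \text{ for all } i,\ \sum_{i=1}^{k}|\lambda_i| = h\right\}$. -}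

module Defs where

open import Data.Nat using (ℕ; zero; suc)
open import Data.Integer using (ℤ; _+_; -_; 0ℤ; _≟_)
open import Data.List using (List; []; _∷_; _++_; map; length; deduplicate)

-- All signed sums  Σ λᵢ xᵢ  with λᵢ ∈ {-1,0,1} and Σ |λᵢ| = h, over the
-- elements of the list (as a list, possibly with repeated values).
signedSums : ℕ → List ℤ → List ℤ
signedSums zero    _        = 0ℤ ∷ []
signedSums (suc h) []       = []
signedSums (suc h) (x ∷ xs) =
  signedSums (suc h) xs
  ++ map (x +_) (signedSums h xs)
  ++ map ((- x) +_) (signedSums h xs)

card-hSignedSumset : ℕ → List ℤ → ℕ
card-hSignedSumset h A = length (deduplicate _≟_ (signedSums h A))

module Submission where

-- Write B = (b₁ < ⋯ < b_h) for the odd elements, so A₁ = B and A₂ = {0} ∪ B ∖ {b₁}, and let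
-- Σ(L) be the set of subset sums of L. A signed sum using every element of L is 2y − ΣL with
-- y ∈ Σ(L); hence |h^∧_± A₁| = |Σ(B)| and, as 0 is forced in A₂, |h^∧_± A₂| = |Σ(B ∖ {b₁})|.
-- Both sets lie in h^∧_± A, and they are disjoint since their elements have the parities of ΣB
-- and ΣB − b₁, which differ because b₁ is odd.
-- For the second bound, |Σ(L)| ≥ |L|² − 1 when L consists of at least 3 increasing odd numbers:
-- appending b > max L creates the new sums b + (ΣL − y) for every y ∈ Σ(L) with y − b ∉ Σ(L), and
-- there are 2|L| + 1 such y, namely 0, the elements of L, the even sums b₁ + c (c ∈ L ∖ {b₁}) and
-- one of b₂ + m, b₁ + b₂ + m (m = max L). So |h^∧_± A| ≥ (h² − 1) + ((h − 1)² − 1) = 2h(h − 1) − 1.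

open import Defs

open import Data.Nat using (ℕ; zero; suc; _+_; _*_; _∸_; ⌊_/2⌋; _≤_; _<_; z≤n; s≤s; _≟_; parity)
open import Data.Nat.Properties hiding (_≟_)
open import Data.Nat.ListAction using (sum)
open import Data.Nat.Divisibility using (_∣_; _∣0; ∣m∣n⇒∣m+n; ∣-refl)
open import Data.Parity.Base as ℙ using (0ℙ; 1ℙ)
open import Data.Parity.Properties using (+-homo-+; p+p≡0ℙ)
import Data.Parity.Properties as ℙ
open import Data.Nat.Tactic.RingSolver using (solve-∀)
open import Data.Integer as ℤ using (ℤ; 0ℤ; -_; _-_)
import Data.Integer.Properties as ℤ
import Data.Integer.Tactic.RingSolver as ℤ-Solver
open import Data.List.Reverse using (Reverse; []; _∶_∶ʳ_; reverseView)
open import Data.Fin using (Fin)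
import Data.Fin as F
open import Algebra.Properties.CommutativeSemigroup +-commutativeSemigroup using (x∙yz≈y∙xz)
open import Data.List using (List; []; _∷_; [_]; _++_; _∷ʳ_; tabulate; map; length; deduplicate)
open import Data.List.Properties using (length-++; length-map; length-removeAt′; length-tabulate)
open import Data.List.Membership.Propositional using (_∈_; _∉_)
open import Data.List.Membership.Propositional.Properties
  using (∈-deduplicate⁺; ∈-deduplicate⁻; ∈-map⁺; ∈-map⁻; ∈-++⁻; ∈-++⁺ˡ; ∈-++⁺ʳ)
open import Data.List.Relation.Unary.Any using (here; there; _─_)
open import Data.List.Relation.Unary.All as All using (All)
import Data.List.Relation.Unary.All.Properties as All
open import Data.List.Relation.Unary.AllPairs as AllPairs using (AllPairs; _∷_; [])
import Data.List.Relation.Unary.AllPairs.Properties as AllPairs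
open import Data.List.Relation.Unary.Unique.Propositional using (Unique)
import Data.List.Relation.Unary.Unique.Propositional.Properties as Unique
open import Data.List.Relation.Unary.Unique.DecPropositional.Properties using (deduplicate-!)
open import Data.List.Relation.Binary.Subset.Propositional using (_⊆_)
open import Data.List.Relation.Binary.Disjoint.Propositional using (Disjoint)
open import Data.Product using (_×_; _,_; ∃; proj₁; proj₂)
open import Data.Sum using (_⊎_; inj₁; inj₂)
open import Function.Definitions using (Injective)
open import Relation.Binary.Definitions using (DecidableEquality)
open import Relation.Binary.PropositionalEquality hiding ([_])
open import Relation.Nullary using (¬_; contradiction; yes; no)
open import Function using (_∘_; case_of_)

-- Lists and counting distinct elements

module _ {A : Set} where

  ∈-─ : ∀ {x z} {ys : List A} (x∈ys : x ∈ ys) → z ∈ ys → z ≢ x → z ∈ (ys ─ x∈ys)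
  ∈-─ (here refl) (here refl) z≢x = contradiction refl z≢x
  ∈-─ (here refl) (there z∈ys) _  = z∈ys
  ∈-─ (there x∈ys) (here refl) _  = here refl
  ∈-─ (there x∈ys) (there z∈ys) z≢x = there (∈-─ x∈ys z∈ys z≢x)

  Unique⇒length≤ : ∀ {xs ys : List A} → Unique xs → xs ⊆ ys → length xs ≤ length ys
  Unique⇒length≤ {[]} _ _ = z≤n
  Unique⇒length≤ {x ∷ xs} {ys} (x∉xs ∷ xs!) xs⊆ys =
    subst (suc (length xs) ≤_) (sym (length-removeAt′ ys _))
      (s≤s (Unique⇒length≤ xs! λ z∈xs →
        ∈-─ x∈ys (xs⊆ys (there z∈xs)) (λ z≡x → All.lookup x∉xs z∈xs (sym z≡x))))
    where
    x∈ys : x ∈ ys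
    x∈ys = xs⊆ys (here refl)

module _ {A : Set} (_≟_ : DecidableEquality A) where

  card : List A → ℕ
  card xs = length (deduplicate _≟_ xs)

  length≤card : ∀ {xs ys} → Unique xs → xs ⊆ ys → length xs ≤ card ys
  length≤card xs! xs⊆ys = Unique⇒length≤ xs! (∈-deduplicate⁺ _≟_ ∘ xs⊆ys)

  card+length≤card : ∀ {xs ys zs} → Unique ys → Disjoint xs ys → xs ⊆ zs → ys ⊆ zs →
                     card xs + length ys ≤ card zs
  card+length≤card {xs} {zs = zs} ys! disj xs⊆zs ys⊆zs =
    subst (_≤ card zs) (length-++ (deduplicate _≟_ xs))
      (length≤card
        (Unique.++⁺ (deduplicate-! _≟_ xs) ys! (λ (p , q) → disj (∈-deduplicate⁻ _≟_ xs p , q)))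
        λ z∈ → case ∈-++⁻ (deduplicate _≟_ xs) z∈ of λ where
          (inj₁ p) → xs⊆zs (∈-deduplicate⁻ _≟_ xs p)
          (inj₂ q) → ys⊆zs q)

  card+card≤card : ∀ {xs ys zs} → Disjoint xs ys → xs ⊆ zs → ys ⊆ zs → card xs + card ys ≤ card zs
  card+card≤card {ys = ys} disj xs⊆zs ys⊆zs =
    card+length≤card (deduplicate-! _≟_ ys) (λ (p , q) → disj (p , ∈-deduplicate⁻ _≟_ ys q))
      xs⊆zs (ys⊆zs ∘ ∈-deduplicate⁻ _≟_ ys)

card-map : ∀ {A B : Set} (_≟ᴬ_ : DecidableEquality A) (_≟ᴮ_ : DecidableEquality B) {f : A → B} →
           Injective _≡_ _≡_ f → ∀ {xs ys} → (∀ {x} → x ∈ xs → f x ∈ ys) →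
           card _≟ᴬ_ xs ≤ card _≟ᴮ_ ys
card-map _≟ᴬ_ _≟ᴮ_ {f} f-inj {xs} {ys} f[xs]⊆ys =
  subst (_≤ card _≟ᴮ_ ys) (length-map f (deduplicate _≟ᴬ_ xs))
    (length≤card _≟ᴮ_ (Unique.map⁺ f-inj (deduplicate-! _≟ᴬ_ xs)) λ y∈ →
      let x , x∈ , y≡fx = ∈-map⁻ f y∈ in
      subst (_∈ _) (sym y≡fx) (f[xs]⊆ys (∈-deduplicate⁻ _≟ᴬ_ xs x∈)))

Unique-map⁺-on : ∀ {A B : Set} {P : A → Set} {f : A → B} →
              (∀ {x y} → P x → P y → f x ≡ f y → x ≡ y) →
              ∀ {xs} → All P xs → Unique xs → Unique (map f xs)
Unique-map⁺-on f-inj {[]} _ _ = []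
Unique-map⁺-on f-inj {x ∷ xs} (px All.∷ pxs) (x∉xs ∷ xs!) =
  All.map⁺ (All.zipWith (λ (py , x≢y) fx≡fy → x≢y (f-inj px py fx≡fy)) (pxs , x∉xs))
  ∷ Unique-map⁺-on f-inj pxs xs!

AllPairs-∷ʳ⁻ : ∀ {A : Set} {R : A → A → Set} xs {x} → AllPairs R (xs ∷ʳ x) →
               AllPairs R xs × All (λ y → R y x) xs
AllPairs-∷ʳ⁻ [] _ = [] , All.[]
AllPairs-∷ʳ⁻ (y ∷ xs) (Ry[xs∷ʳx] ∷ R[xs∷ʳx]) =
  let Ry[xs] , Ryx = All.∷ʳ⁻ Ry[xs∷ʳx]
      R[xs] , R[xs]x = AllPairs-∷ʳ⁻ xs R[xs∷ʳx]
  in Ry[xs] ∷ R[xs] , Ryx All.∷ R[xs]x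

-- A record rather than the equation itself, so that n can be inferred from a proof of Odd n.
record Odd (n : ℕ) : Set where
  constructor odd
  field parity≡1ℙ : parity n ≡ 1ℙ

parity≡0ℙ⇒2∣ : ∀ n → parity n ≡ 0ℙ → 2 ∣ n
parity≡0ℙ⇒2∣ zero          _ = 2 ∣0
parity≡0ℙ⇒2∣ (suc (suc n)) p = ∣m∣n⇒∣m+n (∣-refl {2}) (parity≡0ℙ⇒2∣ n p)

¬2∣⇒Odd : ∀ {n} → ¬ 2 ∣ n → Odd n
¬2∣⇒Odd {n} ¬2∣n with parity n in eq
... | 0ℙ = contradiction (parity≡0ℙ⇒2∣ n eq) ¬2∣n
... | 1ℙ = odd eq

parity-double : ∀ n → parity (n + n) ≡ 0ℙ
parity-double n = trans (+-homo-+ n n) (p+p≡0ℙ (parity n))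

parity-double-+ : ∀ n m → parity (n + n + m) ≡ parity m
parity-double-+ n m = trans (+-homo-+ (n + n) m) (cong (ℙ._+ parity m) (parity-double n))

parity-odd+odd : ∀ {m n} → Odd m → Odd n → parity (m + n) ≡ 0ℙ
parity-odd+odd {m} {n} (odd odd-m) (odd odd-n) rewrite +-homo-+ m n | odd-m | odd-n = refl

Odd⇒¬even : ∀ {n} → Odd n → parity n ≢ 0ℙ
Odd⇒¬even (odd odd-n) even-n = case trans (sym odd-n) even-n of λ ()

Odd⇒≢0 : ∀ {n} → Odd n → n ≢ 0
Odd⇒≢0 odd-n refl = Odd⇒¬even odd-n refl

Odd⇒>0 : ∀ {n} → Odd n → 0 < n
Odd⇒>0 {n} odd-n = n≢0⇒n>0 (Odd⇒≢0 odd-n)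

-- Subset sums

subsetSums : List ℕ → List ℕ
subsetSums []       = [ 0 ]
subsetSums (x ∷ xs) = subsetSums xs ++ map (x +_) (subsetSums xs)

module _ (x : ℕ) (xs : List ℕ) where

  ∈-subsetSums-∷⁺ˡ : ∀ {y} → y ∈ subsetSums xs → y ∈ subsetSums (x ∷ xs)
  ∈-subsetSums-∷⁺ˡ = ∈-++⁺ˡ

  ∈-subsetSums-∷⁺ʳ : ∀ {y} → y ∈ subsetSums xs → x + y ∈ subsetSums (x ∷ xs)
  ∈-subsetSums-∷⁺ʳ y∈ = ∈-++⁺ʳ (subsetSums xs) (∈-map⁺ (x +_) y∈)

  ∈-subsetSums-∷⁻ : ∀ {y} → y ∈ subsetSums (x ∷ xs) →
                    y ∈ subsetSums xs ⊎ ∃ λ y′ → y′ ∈ subsetSums xs × y ≡ x + y′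
  ∈-subsetSums-∷⁻ y∈ with ∈-++⁻ (subsetSums xs) y∈
  ... | inj₁ y∈′ = inj₁ y∈′
  ... | inj₂ y∈′ = inj₂ (∈-map⁻ (x +_) y∈′)

0∈subsetSums : ∀ xs → 0 ∈ subsetSums xs
0∈subsetSums []       = here refl
0∈subsetSums (x ∷ xs) = ∈-subsetSums-∷⁺ˡ x xs (0∈subsetSums xs)

∈-subsetSums-++⁺ : ∀ {u v} xs {ys} → u ∈ subsetSums xs → v ∈ subsetSums ys →
                   u + v ∈ subsetSums (xs ++ ys)
∈-subsetSums-++⁺ [] (here refl) v∈ = v∈
∈-subsetSums-++⁺ {v = v} (x ∷ xs) {ys} u∈ v∈ with ∈-subsetSums-∷⁻ x xs u∈
... | inj₁ u∈′ = ∈-subsetSums-∷⁺ˡ x (xs ++ ys) (∈-subsetSums-++⁺ xs u∈′ v∈)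
... | inj₂ (u′ , u′∈ , refl) =
  subst (_∈ subsetSums (x ∷ xs ++ ys)) (sym (+-assoc x u′ v))
    (∈-subsetSums-∷⁺ʳ x (xs ++ ys) (∈-subsetSums-++⁺ xs u′∈ v∈))

∈⇒∈subsetSums : ∀ {x} xs → x ∈ xs → x ∈ subsetSums xs
∈⇒∈subsetSums (x ∷ xs) (here refl) =
  subst (_∈ subsetSums (x ∷ xs)) (+-identityʳ x) (∈-subsetSums-∷⁺ʳ x xs (0∈subsetSums xs))
∈⇒∈subsetSums (y ∷ xs) (there x∈) = ∈-subsetSums-∷⁺ˡ y xs (∈⇒∈subsetSums xs x∈)

∈-subsetSums-∷ʳ⁺ˡ : ∀ {y} xs b → y ∈ subsetSums xs → y ∈ subsetSums (xs ∷ʳ b)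
∈-subsetSums-∷ʳ⁺ˡ {y} xs b y∈ =
  subst (_∈ subsetSums (xs ∷ʳ b)) (+-identityʳ y) (∈-subsetSums-++⁺ xs y∈ (0∈subsetSums [ b ]))

∈-subsetSums-∷ʳ⁺ʳ : ∀ {y} xs b → y ∈ subsetSums xs → y + b ∈ subsetSums (xs ∷ʳ b)
∈-subsetSums-∷ʳ⁺ʳ xs b y∈ = ∈-subsetSums-++⁺ xs y∈ (∈⇒∈subsetSums [ b ] (here refl))

subsetSums-≤-sum : ∀ xs {y} → y ∈ subsetSums xs → y ≤ sum xs
subsetSums-≤-sum [] (here refl) = z≤n
subsetSums-≤-sum (x ∷ xs) y∈ with ∈-subsetSums-∷⁻ x xs y∈
... | inj₁ y∈′               = ≤-trans (subsetSums-≤-sum xs y∈′) (m≤n+m (sum xs) x)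
... | inj₂ (y′ , y′∈ , refl) = +-monoʳ-≤ x (subsetSums-≤-sum xs y′∈)

subsetSums-complement : ∀ xs {y} → y ∈ subsetSums xs → ∃ λ w → w ∈ subsetSums xs × y + w ≡ sum xs
subsetSums-complement [] (here refl) = 0 , here refl , refl
subsetSums-complement (x ∷ xs) {y} y∈ with ∈-subsetSums-∷⁻ x xs y∈
... | inj₁ y∈′ =
  let w , w∈ , y+w≡ = subsetSums-complement xs y∈′ in
  x + w , ∈-subsetSums-∷⁺ʳ x xs w∈ , trans (x∙yz≈y∙xz y x w) (cong (x +_) y+w≡)
... | inj₂ (y′ , y′∈ , refl) =
  let w , w∈ , y′+w≡ = subsetSums-complement xs y′∈ in
  w , ∈-subsetSums-∷⁺ˡ x xs w∈ , trans (+-assoc x y′ w) (cong (x +_) y′+w≡)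

subsetSums-≡0⊎≥ : ∀ {m} xs → All (m ≤_) xs → ∀ {y} → y ∈ subsetSums xs → y ≡ 0 ⊎ m ≤ y
subsetSums-≡0⊎≥ [] _ (here refl) = inj₁ refl
subsetSums-≡0⊎≥ (x ∷ xs) (m≤x All.∷ m≤xs) y∈ with ∈-subsetSums-∷⁻ x xs y∈
... | inj₁ y∈′               = subsetSums-≡0⊎≥ xs m≤xs y∈′
... | inj₂ (y′ , y′∈ , refl) = inj₂ (≤-trans m≤x (m≤m+n x y′))

subsetSums-even-≡0⊎≥ : ∀ {m} xs → All (m ≤_) xs → All Odd xs →
                       ∀ {y} → y ∈ subsetSums xs → parity y ≡ 0ℙ → y ≡ 0 ⊎ m + m ≤ y
subsetSums-even-≡0⊎≥ [] _ _ (here refl) _ = inj₁ refl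
subsetSums-even-≡0⊎≥ (x ∷ xs) (m≤x All.∷ m≤xs) (odd-x All.∷ odd-xs) y∈ even
  with ∈-subsetSums-∷⁻ x xs y∈
... | inj₁ y∈′ = subsetSums-even-≡0⊎≥ xs m≤xs odd-xs y∈′ even
... | inj₂ (y′ , y′∈ , refl) with subsetSums-≡0⊎≥ xs m≤xs y′∈
...   | inj₂ m≤y′ = inj₂ (+-mono-≤ m≤x m≤y′)
...   | inj₁ refl = contradiction (trans (cong parity (sym (+-identityʳ x))) even) (Odd⇒¬even odd-x)

-- Growth of subset sums when a larger odd number is appended

card-subsetSums-∷ʳ : ∀ L b {Z} → Unique Z → Z ⊆ subsetSums L →
                     All (λ z → z + b ∉ subsetSums L) Z →
                     card _≟_ (subsetSums L) + length Z ≤ card _≟_ (subsetSums (L ∷ʳ b))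
card-subsetSums-∷ʳ L b {Z} Z! Z⊆ shift-new =
  subst (λ n → card _≟_ (subsetSums L) + n ≤ card _≟_ (subsetSums (L ∷ʳ b))) (length-map (_+ b) Z)
    (card+length≤card _≟_ (Unique.map⁺ (+-cancelʳ-≡ b _ _) Z!) disjoint
      (∈-subsetSums-∷ʳ⁺ˡ L b) shifted⊆)
  where
  disjoint : Disjoint (subsetSums L) (map (_+ b) Z)
  disjoint (v∈ , v∈′) with ∈-map⁻ (_+ b) v∈′
  ... | z , z∈ , refl = All.lookup shift-new z∈ v∈
  shifted⊆ : map (_+ b) Z ⊆ subsetSums (L ∷ʳ b)
  shifted⊆ v∈ with ∈-map⁻ (_+ b) v∈
  ... | z , z∈ , refl = ∈-subsetSums-∷ʳ⁺ʳ L b (Z⊆ z∈)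

-- The complement y ↦ ΣL ∸ y of Σ(L) turns the count of z with z + b ∉ Σ(L) into the count of y
-- with y − b ∉ Σ(L).
card-subsetSums-∷ʳ-dual : ∀ L b {Y} → Unique Y → Y ⊆ subsetSums L →
                          All (_∉ map (b +_) (subsetSums L)) Y →
                          card _≟_ (subsetSums L) + length Y ≤ card _≟_ (subsetSums (L ∷ʳ b))
card-subsetSums-∷ʳ-dual L b {Y} Y! Y⊆ unshift-new =
  subst (λ n → card _≟_ (subsetSums L) + n ≤ card _≟_ (subsetSums (L ∷ʳ b))) (length-map (T ∸_) Y)
    (card-subsetSums-∷ʳ L b (Unique-map⁺-on (λ y≤T y′≤T → ∸-cancelˡ-≡ y≤T y′≤T) Y≤T Y!)
      complement⊆ (All.map⁺ (All.tabulate shift-new)))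
  where
  T : ℕ
  T = sum L
  Y≤T : All (_≤ T) Y
  Y≤T = All.tabulate (subsetSums-≤-sum L ∘ Y⊆)
  complement⊆ : map (T ∸_) Y ⊆ subsetSums L
  complement⊆ z∈ with ∈-map⁻ (T ∸_) z∈
  ... | y , y∈ , refl with subsetSums-complement L (Y⊆ y∈)
  ...   | w , w∈ , y+w≡T =
    subst (_∈ subsetSums L) (trans (sym (m+n∸m≡n y w)) (cong (_∸ y) y+w≡T)) w∈
  shift-new : ∀ {y} → y ∈ Y → (T ∸ y) + b ∉ subsetSums L
  shift-new {y} y∈ z+b∈ with subsetSums-complement L z+b∈
  ... | w , w∈ , z+b+w≡T =
    All.lookup unshift-new y∈ (subst (_∈ map (b +_) (subsetSums L)) b+w≡y (∈-map⁺ (b +_) w∈))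
    where
    b+w≡y : b + w ≡ y
    b+w≡y = +-cancelˡ-≡ (T ∸ y) _ _ (begin
      (T ∸ y) + (b + w) ≡⟨ sym (+-assoc (T ∸ y) b w) ⟩
      (T ∸ y) + b + w   ≡⟨ z+b+w≡T ⟩
      T                 ≡⟨ sym (m∸n+n≡m (All.lookup Y≤T y∈)) ⟩
      (T ∸ y) + y       ∎)
      where open ≡-Reasoning

module NewSubsetSums (b₁ b₂ : ℕ) (rest : List ℕ) (b : ℕ)
                     (increasing : AllPairs _<_ ((b₁ ∷ b₂ ∷ rest) ∷ʳ b))
                     (odd-all : All Odd ((b₁ ∷ b₂ ∷ rest) ∷ʳ b)) where

  L : List ℕ
  L = b₁ ∷ b₂ ∷ rest

  increasing-L : AllPairs _<_ L
  increasing-L = proj₁ (AllPairs-∷ʳ⁻ L increasing)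

  below-b : All (_< b) L
  below-b = proj₂ (AllPairs-∷ʳ⁻ L increasing)

  odd-L : All Odd L
  odd-L = proj₁ (All.++⁻ L odd-all)

  odd-b : Odd b
  odd-b = All.head (proj₂ (All.++⁻ L odd-all))

  b₁<b₂ : b₁ < b₂
  b₁<b₂ = All.head (AllPairs.head increasing-L)

  b₂<rest : All (b₂ <_) rest
  b₂<rest = AllPairs.head (AllPairs.tail increasing-L)

  b₁≤L : All (b₁ ≤_) L
  b₁≤L = ≤-refl All.∷ All.map <⇒≤ (AllPairs.head increasing-L)

  b₂≤tail : All (b₂ ≤_) (b₂ ∷ rest)
  b₂≤tail = ≤-refl All.∷ All.map <⇒≤ b₂<rest

  odd-b₁ : Odd b₁
  odd-b₁ = All.head odd-L

  odd-tail : All Odd (b₂ ∷ rest)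
  odd-tail = All.tail odd-L

  sums-below-b₂ : ∀ {y} → y ∈ subsetSums L → y < b₂ → y ≡ 0 ⊎ y ≡ b₁
  sums-below-b₂ y∈ y<b₂ with ∈-subsetSums-∷⁻ b₁ (b₂ ∷ rest) y∈
  ... | inj₁ y∈′ with subsetSums-≡0⊎≥ (b₂ ∷ rest) b₂≤tail y∈′
  ...   | inj₁ y≡0  = inj₁ y≡0
  ...   | inj₂ b₂≤y = contradiction b₂≤y (<⇒≱ y<b₂)
  sums-below-b₂ y∈ y<b₂ | inj₂ (y′ , y′∈ , refl) with subsetSums-≡0⊎≥ (b₂ ∷ rest) b₂≤tail y′∈
  ...   | inj₁ refl  = inj₂ (+-identityʳ b₁)
  ...   | inj₂ b₂≤y′ = contradiction (≤-trans b₂≤y′ (m≤n+m y′ b₁)) (<⇒≱ y<b₂)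

  even-sums-below-b₁+b₂ : ∀ {y} → y ∈ subsetSums L → parity y ≡ 0ℙ → y < b₁ + b₂ → y ≡ 0
  even-sums-below-b₁+b₂ y∈ even y< with ∈-subsetSums-∷⁻ b₁ (b₂ ∷ rest) y∈
  ... | inj₁ y∈′ with subsetSums-even-≡0⊎≥ (b₂ ∷ rest) b₂≤tail odd-tail y∈′ even
  ...   | inj₁ y≡0       = y≡0
  ...   | inj₂ b₂+b₂≤y = contradiction (≤-trans (+-monoˡ-≤ b₂ (<⇒≤ b₁<b₂)) b₂+b₂≤y) (<⇒≱ y<)
  even-sums-below-b₁+b₂ y∈ even y< | inj₂ (y′ , y′∈ , refl)
    with subsetSums-≡0⊎≥ (b₂ ∷ rest) b₂≤tail y′∈
  ...   | inj₁ refl  =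
    contradiction (trans (cong parity (sym (+-identityʳ b₁))) even) (Odd⇒¬even odd-b₁)
  ...   | inj₂ b₂≤y′ = contradiction (+-monoʳ-≤ b₁ b₂≤y′) (<⇒≱ y<)

  even≢b+0 : ∀ {y} → parity y ≡ 0ℙ → y ≢ b + 0
  even≢b+0 even y≡b+0 =
    Odd⇒¬even odd-b (subst (λ n → parity n ≡ 0ℙ) (trans y≡b+0 (+-identityʳ b)) even)

  <b⇒∉shift : ∀ {y} → y < b → y ∉ map (b +_) (subsetSums L)
  <b⇒∉shift y<b y∈ with ∈-map⁻ (b +_) y∈
  ... | w , _ , refl = <⇒≱ y<b (m≤m+n b w)

  b₁+c∉shift : ∀ {c} → c ∈ b₂ ∷ rest → b₁ + c ∉ map (b +_) (subsetSums L)
  b₁+c∉shift {c} c∈ b₁+c∈ with ∈-map⁻ (b +_) b₁+c∈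
  ... | w , w∈ , b₁+c≡b+w with subsetSums-≡0⊎≥ L b₁≤L w∈
  ...   | inj₁ refl = even≢b+0 (parity-odd+odd odd-b₁ (All.lookup odd-tail c∈)) b₁+c≡b+w
  ...   | inj₂ b₁≤w = <⇒≢ (begin-strict
    b₁ + c  <⟨ +-mono-≤-< b₁≤w (All.lookup below-b (there c∈)) ⟩
    w + b   ≡⟨ +-comm w b ⟩
    b + w   ∎) b₁+c≡b+w
    where open ≤-Reasoning

  Y₀ : List ℕ
  Y₀ = 0 ∷ L ++ map (b₁ +_) (b₂ ∷ rest)

  ∈-Y₀⁻ : ∀ {y} → y ∈ Y₀ → y ≡ 0 ⊎ y ∈ L ⊎ ∃ λ c → c ∈ b₂ ∷ rest × y ≡ b₁ + c
  ∈-Y₀⁻ (here y≡0) = inj₁ y≡0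
  ∈-Y₀⁻ (there y∈) with ∈-++⁻ L y∈
  ... | inj₁ y∈L = inj₂ (inj₁ y∈L)
  ... | inj₂ y∈′ = inj₂ (inj₂ (∈-map⁻ (b₁ +_) y∈′))

  length-Y₀ : length Y₀ ≡ length L + length L
  length-Y₀ = begin
    suc (length (L ++ map (b₁ +_) (b₂ ∷ rest)))       ≡⟨ cong suc (length-++ L) ⟩
    suc (length L + length (map (b₁ +_) (b₂ ∷ rest))) ≡⟨ cong (λ n → suc (length L + n))
                                                            (length-map (b₁ +_) (b₂ ∷ rest)) ⟩
    suc (length L + suc (length rest))                ≡⟨ +-suc (length L) (suc (length rest)) ⟨
    length L + length L                               ∎
    where open ≡-Reasoning

  Y₀-unique : Unique Y₀
  Y₀-unique = All.tabulate 0≢ ∷ Unique.++⁺ (AllPairs.map <⇒≢ increasing-L)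
    (Unique.map⁺ (+-cancelˡ-≡ b₁ _ _) (AllPairs.map <⇒≢ (AllPairs.tail increasing-L))) disjoint
    where
    0≢ : ∀ {y} → y ∈ L ++ map (b₁ +_) (b₂ ∷ rest) → 0 ≢ y
    0≢ y∈ 0≡y with ∈-++⁻ L y∈
    ... | inj₁ y∈L = Odd⇒≢0 (All.lookup odd-L y∈L) (sym 0≡y)
    ... | inj₂ y∈′ with ∈-map⁻ (b₁ +_) y∈′
    ...   | c , _ , refl = Odd⇒≢0 odd-b₁ (m+n≡0⇒m≡0 b₁ (sym 0≡y))
    disjoint : Disjoint L (map (b₁ +_) (b₂ ∷ rest))
    disjoint (y∈L , y∈′) with ∈-map⁻ (b₁ +_) y∈′
    ... | c , c∈ , refl =
      Odd⇒¬even (All.lookup odd-L y∈L) (parity-odd+odd odd-b₁ (All.lookup odd-tail c∈))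

  Y₀⊆ : Y₀ ⊆ subsetSums L
  Y₀⊆ y∈ with ∈-Y₀⁻ y∈
  ... | inj₁ refl                    = 0∈subsetSums L
  ... | inj₂ (inj₁ y∈L)              = ∈⇒∈subsetSums L y∈L
  ... | inj₂ (inj₂ (c , c∈ , refl)) = ∈-subsetSums-∷⁺ʳ b₁ (b₂ ∷ rest) (∈⇒∈subsetSums (b₂ ∷ rest) c∈)

  Y₀-new : All (_∉ map (b +_) (subsetSums L)) Y₀
  Y₀-new = All.tabulate new
    where
    new : ∀ {y} → y ∈ Y₀ → y ∉ map (b +_) (subsetSums L)
    new y∈ with ∈-Y₀⁻ y∈
    ... | inj₁ refl                  = <b⇒∉shift (≤-<-trans z≤n (All.head below-b))
    ... | inj₂ (inj₁ y∈L)            = <b⇒∉shift (All.lookup below-b y∈L)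
    ... | inj₂ (inj₂ (c , c∈ , refl)) = b₁+c∉shift c∈

  length-Y₀≤card : length Y₀ ≤ card _≟_ (subsetSums L)
  length-Y₀≤card = length≤card _≟_ Y₀-unique Y₀⊆

  card-subsetSums-∷ʳ-≥ : card _≟_ (subsetSums L) + length Y₀ ≤ card _≟_ (subsetSums (L ∷ʳ b))
  card-subsetSums-∷ʳ-≥ = card-subsetSums-∷ʳ-dual L b Y₀-unique Y₀⊆ Y₀-new

  module _ {m : ℕ} (m∈rest : m ∈ rest) (rest≤m : All (_≤ m) rest) where

    Extra : ℕ → Set
    Extra y = y ∉ Y₀ × y ∈ subsetSums L × y ∉ map (b +_) (subsetSums L)

    b₂<m : b₂ < m
    b₂<m = All.lookup b₂<rest m∈rest

    tail≤m : All (_≤ m) (b₂ ∷ rest)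
    tail≤m = <⇒≤ b₂<m All.∷ rest≤m

    L≤m : All (_≤ m) L
    L≤m = <⇒≤ (<-trans b₁<b₂ b₂<m) All.∷ tail≤m

    odd-b₂ : Odd b₂
    odd-b₂ = All.head odd-tail

    odd-m : Odd m
    odd-m = All.lookup odd-tail (there m∈rest)

    b₂+m∈ : b₂ + m ∈ subsetSums (b₂ ∷ rest)
    b₂+m∈ = ∈-subsetSums-∷⁺ʳ b₂ rest (∈⇒∈subsetSums rest m∈rest)

    extra-b₂+m : b₂ + m ≢ b + b₁ → Extra (b₂ + m)
    extra-b₂+m b₂+m≢b+b₁ = ∉Y₀ , ∈-subsetSums-∷⁺ˡ b₁ (b₂ ∷ rest) b₂+m∈ , new
      where
      even : parity (b₂ + m) ≡ 0ℙ
      even = parity-odd+odd odd-b₂ odd-m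
      ∉Y₀ : b₂ + m ∉ Y₀
      ∉Y₀ b₂+m∈Y₀ with ∈-Y₀⁻ b₂+m∈Y₀
      ... | inj₁ b₂+m≡0 = Odd⇒≢0 odd-b₂ (m+n≡0⇒m≡0 b₂ b₂+m≡0)
      ... | inj₂ (inj₁ ∈L) = Odd⇒¬even (All.lookup odd-L ∈L) even
      ... | inj₂ (inj₂ (c , c∈ , b₂+m≡b₁+c)) =
        <⇒≢ (+-mono-<-≤ b₁<b₂ (All.lookup tail≤m c∈)) (sym b₂+m≡b₁+c)
      w<b₂ : ∀ {w} → b₂ + m ≡ b + w → w < b₂
      w<b₂ {w} b₂+m≡b+w = +-cancelˡ-< b w b₂ (begin-strict
        b + w   ≡⟨ b₂+m≡b+w ⟨
        b₂ + m  <⟨ +-monoʳ-< b₂ (All.lookup below-b (there (there m∈rest))) ⟩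
        b₂ + b  ≡⟨ +-comm b₂ b ⟩
        b + b₂  ∎)
        where open ≤-Reasoning
      new : b₂ + m ∉ map (b +_) (subsetSums L)
      new b₂+m∈′ with ∈-map⁻ (b +_) b₂+m∈′
      ... | w , w∈ , b₂+m≡b+w with sums-below-b₂ w∈ (w<b₂ b₂+m≡b+w)
      ... | inj₁ refl = even≢b+0 even b₂+m≡b+w
      ... | inj₂ refl = b₂+m≢b+b₁ b₂+m≡b+w

    extra-b₁+b₂+m : b₂ + m ≡ b + b₁ → Extra (b₁ + (b₂ + m))
    extra-b₁+b₂+m b₂+m≡b+b₁ = ∉Y₀ , ∈-subsetSums-∷⁺ʳ b₁ (b₂ ∷ rest) b₂+m∈ , new
      where
      odd-sum : Odd (b₁ + (b₂ + m))
      odd-sum = odd (begin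
        parity (b₁ + (b₂ + m))   ≡⟨ +-homo-+ b₁ (b₂ + m) ⟩
        parity b₁ ℙ.+ parity (b₂ + m) ≡⟨ cong (parity b₁ ℙ.+_) (parity-odd+odd odd-b₂ odd-m) ⟩
        parity b₁ ℙ.+ 0ℙ         ≡⟨ ℙ.+-identityʳ (parity b₁) ⟩
        parity b₁                ≡⟨ Odd.parity≡1ℙ odd-b₁ ⟩
        1ℙ                       ∎)
        where open ≡-Reasoning
      ∉Y₀ : b₁ + (b₂ + m) ∉ Y₀
      ∉Y₀ ∈Y₀ with ∈-Y₀⁻ ∈Y₀
      ... | inj₁ ≡0 = Odd⇒≢0 odd-b₁ (m+n≡0⇒m≡0 b₁ ≡0)
      ... | inj₂ (inj₁ ∈L) =
        <⇒≱ (≤-<-trans (m≤n+m m b₂) (m<n+m (b₂ + m) (Odd⇒>0 odd-b₁))) (All.lookup L≤m ∈L)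
      ... | inj₂ (inj₂ (c , c∈ , ≡b₁+c)) = Odd⇒¬even odd-sum
        (trans (cong parity ≡b₁+c) (parity-odd+odd odd-b₁ (All.lookup odd-tail c∈)))
      new : b₁ + (b₂ + m) ∉ map (b +_) (subsetSums L)
      new ∈shift with ∈-map⁻ (b +_) ∈shift
      ... | w , w∈ , b₁+b₂+m≡b+w = Odd⇒≢0 odd-b₁ (m+n≡0⇒m≡0 b₁ (trans (sym w≡b₁+b₁) w≡0))
        where
        w≡b₁+b₁ : w ≡ b₁ + b₁
        w≡b₁+b₁ = +-cancelˡ-≡ b _ _ (begin
          b + w            ≡⟨ sym b₁+b₂+m≡b+w ⟩
          b₁ + (b₂ + m)    ≡⟨ cong (b₁ +_) b₂+m≡b+b₁ ⟩
          b₁ + (b + b₁)    ≡⟨ x∙yz≈y∙xz b₁ b b₁ ⟩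
          b + (b₁ + b₁)    ∎)
          where open ≡-Reasoning
        w≡0 : w ≡ 0
        w≡0 = even-sums-below-b₁+b₂ w∈
                (subst (λ n → parity n ≡ 0ℙ) (sym w≡b₁+b₁) (parity-double b₁))
                (subst (_< b₁ + b₂) (sym w≡b₁+b₁) (+-monoʳ-< b₁ b₁<b₂))

    -- b₂ + m only fails when b₂ + m − b = b₁; then b₁ + b₂ + m − b = 2b₁ would be an even subset
    -- sum below b₁ + b₂, hence 0.
    extra : ∃ Extra
    extra with b₂ + m ≟ b + b₁
    ... | no  b₂+m≢b+b₁ = _ , extra-b₂+m b₂+m≢b+b₁
    ... | yes b₂+m≡b+b₁ = _ , extra-b₁+b₂+m b₂+m≡b+b₁

    card-subsetSums-∷ʳ-≥-suc :
      card _≟_ (subsetSums L) + suc (length Y₀) ≤ card _≟_ (subsetSums (L ∷ʳ b))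
    card-subsetSums-∷ʳ-≥-suc with extra
    ... | y , y∉Y₀ , y∈ , y-new =
      card-subsetSums-∷ʳ-dual L b (All.¬Any⇒All¬ Y₀ y∉Y₀ ∷ Y₀-unique)
        (λ { (here refl) → y∈ ; (there z∈) → Y₀⊆ z∈ }) (y-new All.∷ Y₀-new)

length-∷ʳ : ∀ {A : Set} (xs : List A) x → length (xs ∷ʳ x) ≡ suc (length xs)
length-∷ʳ xs x = trans (length-++ xs) (+-comm (length xs) 1)

square-suc-≤ : ∀ n {c c′} → n * n ≤ suc c → c + suc (n + n) ≤ c′ → suc n * suc n ≤ suc c′
square-suc-≤ n {c} {c′} n²≤1+c growth = begin
  suc n * suc n         ≡⟨ [1+n]²≡n²+[1+2n] n ⟩
  n * n + suc (n + n)   ≤⟨ +-monoˡ-≤ (suc (n + n)) n²≤1+c ⟩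
  suc (c + suc (n + n)) ≤⟨ s≤s growth ⟩
  suc c′                ∎
  where
  open ≤-Reasoning
  [1+n]²≡n²+[1+2n] : ∀ n → suc n * suc n ≡ n * n + suc (n + n)
  [1+n]²≡n²+[1+2n] = solve-∀

length²≤1+card-subsetSums : ∀ {L} → Reverse L → AllPairs _<_ L → All Odd L → 3 ≤ length L →
                            length L * length L ≤ suc (card _≟_ (subsetSums L))
length²≤1+card-subsetSums (_ ∶ [] ∶ʳ _) _ _ (s≤s ())
length²≤1+card-subsetSums (_ ∶ ([] ∶ _ ∶ʳ _) ∶ʳ _) _ _ (s≤s (s≤s ()))
-- For |L| = 2 only the |Y₀| = 4 new sums are guaranteed, but then also |Σ(b₁, b₂)| ≥ |Y₀| = 4,
-- so 3² ≤ 1 + (4 + 4).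
length²≤1+card-subsetSums (_ ∶ ((b₁ ∷ []) ∶ _ ∶ʳ b₂) ∶ʳ b) increasing odd-all _ =
  s≤s (≤-trans (+-monoˡ-≤ 4 length-Y₀≤card) card-subsetSums-∷ʳ-≥)
  where open NewSubsetSums b₁ b₂ [] b increasing odd-all
length²≤1+card-subsetSums (_ ∶ L-view@((b₁ ∷ b₂ ∷ rs) ∶ _ ∶ʳ m) ∶ʳ b) increasing odd-all _ =
  subst (λ n → n * n ≤ suc (card _≟_ (subsetSums (L ∷ʳ b)))) (sym (length-∷ʳ L b))
    (square-suc-≤ (length L) (length²≤1+card-subsetSums L-view increasing-L odd-L 3≤length-L)
      (subst (λ k → card _≟_ (subsetSums L) + suc k ≤ card _≟_ (subsetSums (L ∷ʳ b))) length-Y₀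
        (card-subsetSums-∷ʳ-≥-suc (∈-++⁺ʳ rs (here refl)) rs∷ʳm≤m)))
  where
  open NewSubsetSums b₁ b₂ (rs ∷ʳ m) b increasing odd-all
  3≤length-L : 3 ≤ length L
  3≤length-L = s≤s (s≤s (subst (1 ≤_) (sym (length-∷ʳ rs m)) (s≤s z≤n)))
  rs∷ʳm≤m : All (_≤ m) (rs ∷ʳ m)
  rs∷ʳm≤m = All.++⁺ (All.map <⇒≤ (All.drop⁺ 2 (proj₂ (AllPairs-∷ʳ⁻ (b₁ ∷ b₂ ∷ rs) increasing-L))))
                    (≤-refl All.∷ All.[])

-- Signed sums

-- The signed sum taking + on a sub-multiset of sum y and − on the rest,
-- when all the elements add up to T.
signedSum : ℕ → ℕ → ℤ
signedSum T y = ℤ.+ (y + y) - ℤ.+ T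

signedSum-∷-skip : ∀ x T y → - (ℤ.+ x) ℤ.+ signedSum T y ≡ signedSum (x + T) y
signedSum-∷-skip x T y rewrite ℤ.pos-+ x T = lemma (ℤ.+ (y + y)) (ℤ.+ x) (ℤ.+ T)
  where lemma : ∀ Y X T → - X ℤ.+ (Y - T) ≡ Y - (X ℤ.+ T)
        lemma = ℤ-Solver.solve-∀

signedSum-∷-take : ∀ x T y → ℤ.+ x ℤ.+ signedSum T y ≡ signedSum (x + T) (x + y)
signedSum-∷-take x T y
  rewrite ℤ.pos-+ (x + y) (x + y) | ℤ.pos-+ x y | ℤ.pos-+ y y | ℤ.pos-+ x T =
  lemma (ℤ.+ x) (ℤ.+ y) (ℤ.+ T)
  where lemma : ∀ X Y T → X ℤ.+ ((Y ℤ.+ Y) - T) ≡ ((X ℤ.+ Y) ℤ.+ (X ℤ.+ Y)) - (X ℤ.+ T)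
        lemma = ℤ-Solver.solve-∀

signedSum-cross : ∀ T y T′ y′ → signedSum T y ≡ signedSum T′ y′ → y + y + T′ ≡ y′ + y′ + T
signedSum-cross T y T′ y′ eq = ℤ.+-injective (begin
  ℤ.+ (y + y + T′)                         ≡⟨ ℤ.pos-+ (y + y) T′ ⟩
  ℤ.+ (y + y) ℤ.+ ℤ.+ T′                   ≡⟨ lemma (ℤ.+ (y + y)) (ℤ.+ T) (ℤ.+ T′) ⟩
  signedSum T y ℤ.+ (ℤ.+ T ℤ.+ ℤ.+ T′)     ≡⟨ cong (ℤ._+ (ℤ.+ T ℤ.+ ℤ.+ T′)) eq ⟩
  signedSum T′ y′ ℤ.+ (ℤ.+ T ℤ.+ ℤ.+ T′)   ≡⟨ lemma′ (ℤ.+ (y′ + y′)) (ℤ.+ T) (ℤ.+ T′) ⟩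
  ℤ.+ (y′ + y′) ℤ.+ ℤ.+ T                  ≡⟨ ℤ.pos-+ (y′ + y′) T ⟨
  ℤ.+ (y′ + y′ + T)                        ∎)
  where
  open ≡-Reasoning
  lemma : ∀ Y T T′ → Y ℤ.+ T′ ≡ (Y - T) ℤ.+ (T ℤ.+ T′)
  lemma = ℤ-Solver.solve-∀
  lemma′ : ∀ Y T T′ → (Y - T′) ℤ.+ (T ℤ.+ T′) ≡ Y ℤ.+ T
  lemma′ = ℤ-Solver.solve-∀

signedSum-injective : ∀ T {y y′} → signedSum T y ≡ signedSum T y′ → y ≡ y′
signedSum-injective T {y} {y′} eq = begin
  y              ≡⟨ n≡⌊n+n/2⌋ y ⟩
  ⌊ y + y /2⌋    ≡⟨ cong ⌊_/2⌋ (+-cancelʳ-≡ T _ _ (signedSum-cross T y T y′ eq)) ⟩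
  ⌊ y′ + y′ /2⌋  ≡⟨ n≡⌊n+n/2⌋ y′ ⟨
  y′             ∎
  where open ≡-Reasoning

signedSums-length : ∀ k xs {v} → v ∈ signedSums k xs → k ≤ length xs
signedSums-length zero    _        _  = z≤n
signedSums-length (suc k) (x ∷ xs) v∈ with ∈-++⁻ (signedSums (suc k) xs) v∈
... | inj₁ v∈′ = m≤n⇒m≤1+n (signedSums-length (suc k) xs v∈′)
... | inj₂ v∈′ with ∈-++⁻ (map (ℤ._+_ x) (signedSums k xs)) v∈′
...   | inj₁ v∈″ = let _ , w∈ , _ = ∈-map⁻ (ℤ._+_ x) v∈″ in s≤s (signedSums-length k xs w∈)
...   | inj₂ v∈″ = let _ , w∈ , _ = ∈-map⁻ (ℤ._+_ (- x)) v∈″ in s≤s (signedSums-length k xs w∈)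

∈-signedSums⁺ : ∀ {n} xs → length xs ≡ n → ∀ {y} → y ∈ subsetSums xs →
                signedSum (sum xs) y ∈ signedSums n (map ℤ.+_ xs)
∈-signedSums⁺ [] refl (here refl) = here refl
∈-signedSums⁺ (x ∷ xs) refl {y} y∈ with ∈-subsetSums-∷⁻ x xs y∈
... | inj₁ y∈′ =
  ∈-++⁺ʳ (signedSums (suc (length xs)) (map ℤ.+_ xs)) (∈-++⁺ʳ (map (ℤ._+_ (ℤ.+ x)) S)
    (subst (_∈ map (ℤ._+_ (- (ℤ.+ x))) S) (signedSum-∷-skip x (sum xs) y)
      (∈-map⁺ (ℤ._+_ (- (ℤ.+ x))) (∈-signedSums⁺ xs refl y∈′))))
  where S = signedSums (length xs) (map ℤ.+_ xs)
... | inj₂ (y′ , y′∈ , refl) =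
  ∈-++⁺ʳ (signedSums (suc (length xs)) (map ℤ.+_ xs)) (∈-++⁺ˡ
    (subst (_∈ map (ℤ._+_ (ℤ.+ x)) S) (signedSum-∷-take x (sum xs) y′)
      (∈-map⁺ (ℤ._+_ (ℤ.+ x)) (∈-signedSums⁺ xs refl y′∈))))
  where S = signedSums (length xs) (map ℤ.+_ xs)

∈-signedSums⁻ : ∀ {n} xs → length xs ≡ n → ∀ {v} → v ∈ signedSums n (map ℤ.+_ xs) →
                ∃ λ y → y ∈ subsetSums xs × v ≡ signedSum (sum xs) y
∈-signedSums⁻ [] refl (here refl) = 0 , here refl , refl
∈-signedSums⁻ (x ∷ xs) refl v∈ with ∈-++⁻ (signedSums (suc (length xs)) (map ℤ.+_ xs)) v∈
... | inj₁ v∈′ = contradiction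
  (≤-trans (signedSums-length _ (map ℤ.+_ xs) v∈′) (≤-reflexive (length-map ℤ.+_ xs)))
  (n≮n (length xs))
... | inj₂ v∈′ with ∈-++⁻ (map (ℤ._+_ (ℤ.+ x)) (signedSums (length xs) (map ℤ.+_ xs))) v∈′
...   | inj₁ v∈″ with ∈-map⁻ (ℤ._+_ (ℤ.+ x)) v∈″
...     | w , w∈ , refl with ∈-signedSums⁻ xs refl w∈
...       | y , y∈ , refl = x + y , ∈-subsetSums-∷⁺ʳ x xs y∈ , signedSum-∷-take x (sum xs) y
∈-signedSums⁻ (x ∷ xs) refl v∈ | inj₂ v∈′ | inj₂ v∈″ with ∈-map⁻ (ℤ._+_ (- (ℤ.+ x))) v∈″
...     | w , w∈ , refl with ∈-signedSums⁻ xs refl w∈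
...       | y , y∈ , refl = y , ∈-subsetSums-∷⁺ˡ x xs y∈ , signedSum-∷-skip x (sum xs) y

∈-signedSums-∷⁺ : ∀ k x xs {v} → v ∈ signedSums k xs → v ∈ signedSums k (x ∷ xs)
∈-signedSums-∷⁺ zero    _ _ v∈ = v∈
∈-signedSums-∷⁺ (suc k) _ _ v∈ = ∈-++⁺ˡ v∈

∈-signedSums-0∷⁺ : ∀ k xs {v} → v ∈ signedSums k xs → v ∈ signedSums (suc k) (0ℤ ∷ xs)
∈-signedSums-0∷⁺ k xs {v} v∈ =
  ∈-++⁺ʳ (signedSums (suc k) xs) (∈-++⁺ˡ
    (subst (_∈ map (ℤ._+_ 0ℤ) (signedSums k xs)) (ℤ.+-identityˡ v) (∈-map⁺ (ℤ._+_ 0ℤ) v∈)))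

∈-signedSums-0∷⁻ : ∀ k xs {v} → length xs ≤ k → v ∈ signedSums (suc k) (0ℤ ∷ xs) →
                   v ∈ signedSums k xs
∈-signedSums-0∷⁻ k xs length≤k v∈ with ∈-++⁻ (signedSums (suc k) xs) v∈
... | inj₁ v∈′ = contradiction (≤-trans (signedSums-length (suc k) xs v∈′) length≤k) (n≮n k)
... | inj₂ v∈′ with ∈-++⁻ (map (ℤ._+_ 0ℤ) (signedSums k xs)) v∈′
...   | inj₁ v∈″ = let w , w∈ , v≡0+w = ∈-map⁻ (ℤ._+_ 0ℤ) v∈″ in
  subst (_∈ signedSums k xs) (sym (trans v≡0+w (ℤ.+-identityˡ w))) w∈
...   | inj₂ v∈″ = let w , w∈ , v≡-0+w = ∈-map⁻ (ℤ._+_ (- 0ℤ)) v∈″ in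
  subst (_∈ signedSums k xs) (sym (trans v≡-0+w (ℤ.+-identityˡ w))) w∈

-- With A = {0, x} ∪ xs and h = |xs| + 1: S = h^∧_± A, S₁ = h^∧_± A₁ and S₂ = h^∧_± A₂.
module _ (x : ℕ) (xs : List ℕ) {n : ℕ} (length-xs : length xs ≡ n) where

  private
    S S₁ S₂ : List ℤ
    S  = signedSums (suc n) (0ℤ ∷ map ℤ.+_ (x ∷ xs))
    S₁ = signedSums (suc n) (map ℤ.+_ (x ∷ xs))
    S₂ = signedSums (suc n) (0ℤ ∷ map ℤ.+_ xs)

    S₂⊆signedSums[xs] : S₂ ⊆ signedSums n (map ℤ.+_ xs)
    S₂⊆signedSums[xs] =
      ∈-signedSums-0∷⁻ n (map ℤ.+_ xs) (≤-reflexive (trans (length-map ℤ.+_ xs) length-xs))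

  card-signedSums-split : Odd x → card ℤ._≟_ S₁ + card ℤ._≟_ S₂ ≤ card ℤ._≟_ S
  card-signedSums-split odd-x = card+card≤card ℤ._≟_ disjoint ∈-++⁺ˡ
    (∈-signedSums-0∷⁺ n (map ℤ.+_ (x ∷ xs)) ∘ ∈-signedSums-∷⁺ n (ℤ.+ x) (map ℤ.+_ xs)
                                           ∘ S₂⊆signedSums[xs])
    where
    disjoint : Disjoint S₁ S₂
    disjoint (v∈S₁ , v∈S₂) with ∈-signedSums⁻ (x ∷ xs) (cong suc length-xs) v∈S₁
                              | ∈-signedSums⁻ xs length-xs (S₂⊆signedSums[xs] v∈S₂)
    ... | y , _ , refl | y′ , _ , eq =
      Odd⇒¬even odd-x (ℙ.+-cancelʳ-≡ (parity (sum xs)) (parity x) 0ℙ (begin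
        parity x ℙ.+ parity (sum xs)    ≡⟨ +-homo-+ x (sum xs) ⟨
        parity (x + sum xs)             ≡⟨ parity-double-+ y′ (x + sum xs) ⟨
        parity (y′ + y′ + (x + sum xs)) ≡⟨ cong parity (signedSum-cross (x + sum xs) y (sum xs) y′ eq) ⟨
        parity (y + y + sum xs)         ≡⟨ parity-double-+ y (sum xs) ⟩
        parity (sum xs)                 ∎))
      where open ≡-Reasoning

  card-subsetSums≤card-signedSums : card _≟_ (subsetSums (x ∷ xs)) ≤ card ℤ._≟_ S₁
  card-subsetSums≤card-signedSums =
    card-map _≟_ ℤ._≟_ (signedSum-injective (sum (x ∷ xs)))
      (∈-signedSums⁺ (x ∷ xs) (cong suc length-xs))

  card-subsetSums≤card-signedSums-0∷ : card _≟_ (subsetSums xs) ≤ card ℤ._≟_ S₂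
  card-subsetSums≤card-signedSums-0∷ =
    card-map _≟_ ℤ._≟_ (signedSum-injective (sum xs))
      (∈-signedSums-0∷⁺ n (map ℤ.+_ xs) ∘ ∈-signedSums⁺ xs length-xs)

n²≤1+card-subsetSums-tabulate : ∀ {n} (f : Fin n → ℕ) → 3 ≤ n → (∀ {i j} → i F.< j → f i < f j) →
                           (∀ i → Odd (f i)) → n * n ≤ suc (card _≟_ (subsetSums (tabulate f)))
n²≤1+card-subsetSums-tabulate f 3≤n increasing odd-f =
  subst (λ k → k * k ≤ suc (card _≟_ (subsetSums (tabulate f)))) (length-tabulate f)
    (length²≤1+card-subsetSums (reverseView (tabulate f)) (AllPairs.tabulate⁺-< increasing)
      (All.tabulate⁺ odd-f) (subst (3 ≤_) (sym (length-tabulate f)) 3≤n))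

consecutive-squares-bound : ∀ n {c₁ c₂} → suc n * suc n ≤ suc c₁ → n * n ≤ suc c₂ →
                            2 * suc n * n ∸ 1 ≤ c₁ + c₂
consecutive-squares-bound n {c₁} {c₂} [1+n]²≤ n²≤ = ∸-monoˡ-≤ 1 (≤-pred (begin
  suc (2 * suc n * n)     ≡⟨ identity n ⟩
  suc n * suc n + n * n   ≤⟨ +-mono-≤ [1+n]²≤ n²≤ ⟩
  suc c₁ + suc c₂         ≡⟨ cong suc (+-suc c₁ c₂) ⟩
  suc (suc (c₁ + c₂))     ∎))
  where
  open ≤-Reasoning
  identity : ∀ n → suc (2 * suc n * n) ≡ suc n * suc n + n * n
  identity = solve-∀

-- The statement's vocabulary is opened only here: the constructor +_ of ℤ makes ℕ-sections such
-- as (x +_) ambiguous.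
open import Data.Nat using (_≥_)
open import Data.Integer using (+_)
open import Data.List using (drop)

lemma2p7 : (h : ℕ) → 4 ≤ h → (a : Fin h → ℕ)
  → (∀ i → 0 < a i)
  → (∀ i j → i F.< j → a i < a j)
  → (∀ i → ¬ (2 ∣ a i))
  → (card-hSignedSumset h (0ℤ ∷ map +_ (tabulate a))
       ≥ card-hSignedSumset h (map +_ (tabulate a))
         + card-hSignedSumset h (0ℤ ∷ drop 1 (map +_ (tabulate a))))
    × (card-hSignedSumset h (0ℤ ∷ map +_ (tabulate a)) ≥ 2 * h * (h ∸ 1) ∸ 1)
lemma2p7 zero () _ _ _ _
-- Positivity is implied by oddness.
lemma2p7 (suc h′) 4≤h a _ increasing not-even = split , ≤-trans bound split
  where
  x : ℕ
  x = a F.zero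
  xs : List ℕ
  xs = tabulate (a ∘ F.suc)
  length-xs : length xs ≡ h′
  length-xs = length-tabulate (a ∘ F.suc)
  odd-a : ∀ i → Odd (a i)
  odd-a i = ¬2∣⇒Odd (not-even i)

  split : card-hSignedSumset (suc h′) (map +_ (x ∷ xs))
          + card-hSignedSumset (suc h′) (0ℤ ∷ map +_ xs)
          ≤ card-hSignedSumset (suc h′) (0ℤ ∷ map +_ (x ∷ xs))
  split = card-signedSums-split x xs length-xs (odd-a F.zero)

  [1+h′]²≤ : suc h′ * suc h′ ≤ suc (card-hSignedSumset (suc h′) (map +_ (x ∷ xs)))
  [1+h′]²≤ = ≤-trans (n²≤1+card-subsetSums-tabulate a (<⇒≤ 4≤h) (increasing _ _) odd-a)
                     (s≤s (card-subsetSums≤card-signedSums x xs length-xs))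

  h′²≤ : h′ * h′ ≤ suc (card-hSignedSumset (suc h′) (0ℤ ∷ map +_ xs))
  h′²≤ = ≤-trans (n²≤1+card-subsetSums-tabulate (a ∘ F.suc) (≤-pred 4≤h)
                    (λ i<j → increasing _ _ (s≤s i<j)) (odd-a ∘ F.suc))
                 (s≤s (card-subsetSums≤card-signedSums-0∷ x xs length-xs))

  bound : 2 * suc h′ * h′ ∸ 1 ≤ card-hSignedSumset (suc h′) (map +_ (x ∷ xs))
                                + card-hSignedSumset (suc h′) (0ℤ ∷ map +_ xs)
  bound = consecutive-squares-bound h′ [1+h′]²≤ h′²≤
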